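{- Let $T$ be a tree with at least one core, let $L\subseteq V$ be a landmark set of $T$, and let $v$ be a core of $T$. Then $L$ contains, as a subset, a local set of $v$.
   Context: Let $T=(V,E)$ be a finite tree and $d(x,y)$ the number of edges on the path between $x$ and $y$. A vertex $\tau$ separates $u$ and $w$ if $d(u,\tau)\neq d(w,\tau)$. A set $L\subseteq V$ is a landmark set if every pair of distinct vertices $u,w\in V\setminus L$ is separated by at least two vertices of $L$. A core is a vertex of degree at least $3$. For a vertex $v$, the subtrees of the neighbors of $v$ are the connected components of $T-v$. A (standard) leg of a core $v$ is a subtree of a neighbor of $v$ containing no core (a path attached to $v$); it is short if it has one vertex and long otherwise. For a leg $\ell$ of $v$, $\ell^i$ denotes the vertex of $\ell$ at distance $i$ from $v$ (its position is $i$). A small core is a core of degree exactly $3$ with at least two legs, at least one of which is short; other cores are regular. A modified leg of a core $v$ is a subtree of a neighbor of $v$ containing exactly one core, which is a small core $w$; the position of a vertex on it is its distance from $v$; if $w$ has position $i$, the two vertices of position $i+1$ are $\ell^a,\ell^b$, where $\ell^b$ is the vertex of a short leg of $w$ (chosen arbitrarily if both legs of $w$ inside $\ell$ are short). A g-leg of $v$ is a standard leg or a modified leg of $v$. Solution types. For a set $S$ and a standard leg $\ell$, $S\cap\ell$ is of type $(s,0)$ if empty; $(s,1)$ if it is a single vertex of position at least $2$; $(s,2)$ if it has at least two vertices; $(s,3)$ if it equals $\{\ell^1\}$. For a modified leg $\ell$ whose small core has position $i$: type $(m,1)$ if $S\cap\ell$ equals $\{\ell^a\}$ or $\{\ell^b\}$;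 type $(m,2)$ if it contains neither $\ell^a$ nor $\ell^b$ and contains at least two vertices of position at least $i+2$; type $(m,3)$ if it has at least two vertices, at least one of which is $\ell^a$ or $\ell^b$. A local set of a core $v$ is a set $S$ of vertices of the g-legs of $v$ (so $v\notin S$) such that: (1) at most one standard leg has type $(s,0)$ and all other standard legs have type $(s,1)$, $(s,2)$ or $(s,3)$; (2) every modified leg has type $(m,1)$, $(m,2)$ or $(m,3)$; (3) if some standard leg has type $(s,0)$ then no modified leg has type $(m,1)$; (4) if some long leg $\ell$ has type $(s,0)$ then every long leg other than $\ell$ has type $(s,2)$; (5) if some short leg has type $(s,0)$ then every long leg has type $(s,2)$ or $(s,3)$. -}

module Defs where

open import Data.Nat using (ℕ; zero; suc; _≤_; _+_)
open import Data.Bool using (Bool; true; false; T; if_then_else_)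
open import Data.Fin using (Fin)
open import Data.Fin.Subset using (Subset; _∈_; _∉_)
open import Data.List using (List; []; _∷_; map; allFin)
open import Data.Nat.ListAction using (sum)
open import Data.List.Membership.Propositional using () renaming (_∈_ to _∈ₗ_; _∉_ to _∉ₗ_)
open import Data.List.Relation.Unary.Unique.Propositional using (Unique)
open import Data.Product using (Σ; ∃; ∃-syntax; _×_; _,_; proj₁)
open import Data.Sum using (_⊎_)
open import Data.Empty using (⊥)
open import Relation.Nullary using (¬_)
open import Relation.Binary.PropositionalEquality using (_≡_; _≢_)

module WalkDefs {n : ℕ} (adj : Fin n → Fin n → Bool) where

  data Walk : Fin n → Fin n → Set where
    []  : ∀ {x} → Walk x x
    _∷_ : ∀ {x y z} → T (adj x y) → Walk y z → Walk x z

  verts : ∀ {x y} → Walk x y → List (Fin n)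
  verts {x} []       = x ∷ []
  verts {x} (_ ∷ w)  = x ∷ verts w

  len : ∀ {x y} → Walk x y → ℕ
  len []      = 0
  len (_ ∷ w) = suc (len w)

  IsPath : ∀ {x y} → Walk x y → Set
  IsPath w = Unique (verts w)

open WalkDefs public

record Tree (n : ℕ) : Set where
  field
    adj       : Fin n → Fin n → Bool
    adj-sym   : ∀ x y → adj x y ≡ adj y x
    adj-irr   : ∀ x → adj x x ≡ false
    connected : ∀ x y → Σ (Walk adj x y) (IsPath adj)
    -- acyclic: no cycle, i.e. no path x … y with at least 3 vertices
    -- closed up by an edge y x
    acyclic   : ∀ x y (p : Walk adj x y) → IsPath adj p → 2 ≤ len adj p →
                T (adj y x) → ⊥

module TreeDefs {n : ℕ} (𝒯 : Tree n) where
  open Tree 𝒯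

  -- d(x,y) = number of edges of the (unique) path between x and y
  d : Fin n → Fin n → ℕ
  d x y = len adj (proj₁ (connected x y))

  Separates : Fin n → Fin n → Fin n → Set
  Separates τ u w = d u τ ≢ d w τ

  IsLandmarkSet : Subset n → Set
  IsLandmarkSet L = ∀ u w → u ≢ w → u ∉ L → w ∉ L →
    ∃[ τ₁ ] ∃[ τ₂ ] (τ₁ ≢ τ₂ × τ₁ ∈ L × τ₂ ∈ L × Separates τ₁ u w × Separates τ₂ u w)

  deg : Fin n → ℕ
  deg x = sum (map (λ y → if adj x y then 1 else 0) (allFin n))

  Core : Fin n → Set
  Core x = 3 ≤ deg x

  -- Branch v u w : u is a neighbour of v and w lies in the subtree of u,
  -- i.e. the connected component of T - v containing u
  Branch : Fin n → Fin n → Fin n → Set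
  Branch v u w = T (adj v u) × Σ (Walk adj u w) (λ p → v ∉ₗ verts adj p)

  Leg : Fin n → Fin n → Set
  Leg v u = T (adj v u) × (∀ c → Branch v u c → ¬ Core c)

  ShortLeg : Fin n → Fin n → Set
  ShortLeg v u = Leg v u × (∀ x → Branch v u x → x ≡ u)

  LongLeg : Fin n → Fin n → Set
  LongLeg v u = Leg v u × ∃[ x ] (Branch v u x × x ≢ u)

  SmallCore : Fin n → Set
  SmallCore w = Core w × deg w ≡ 3 ×
    ∃[ u₁ ] ∃[ u₂ ] (u₁ ≢ u₂ × Leg w u₁ × Leg w u₂ × ShortLeg w u₁)

  RegularCore : Fin n → Set
  RegularCore w = Core w × ¬ SmallCore w

  ModLeg : Fin n → Fin n → Fin n → Set
  ModLeg v u w = T (adj v u) × Branch v u w × SmallCore w ×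
    (∀ c → Branch v u c → Core c → c ≡ w)

  GLeg : Fin n → Fin n → Set
  GLeg v u = Leg v u ⊎ ∃[ w ] ModLeg v u w

  module Types (S : Subset n) (v : Fin n) where

    -- solution types for a standard leg at neighbour u (ℓ¹ = u)
    TypeS0 TypeS1 TypeS2 TypeS3 : Fin n → Set
    TypeS0 u = ∀ x → Branch v u x → x ∉ S
    TypeS1 u = ∃[ x ] (Branch v u x × x ∈ S × 2 ≤ d v x ×
                       (∀ y → Branch v u y → y ∈ S → y ≡ x))
    TypeS2 u = ∃[ x ] ∃[ y ] (x ≢ y × Branch v u x × Branch v u y × x ∈ S × y ∈ S)
    TypeS3 u = u ∈ S × (∀ y → Branch v u y → y ∈ S → y ≡ u)

    -- ℓᵃ, ℓᵇ of the modified leg at u with small core w: the vertices of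
    -- the leg of position (position of w) + 1
    IsAB : Fin n → Fin n → Fin n → Set
    IsAB u w x = Branch v u x × d v x ≡ suc (d v w)

    TypeM1 TypeM2 TypeM3 : Fin n → Fin n → Set
    TypeM1 u w = ∃[ x ] (IsAB u w x × x ∈ S × (∀ y → Branch v u y → y ∈ S → y ≡ x))
    TypeM2 u w = (∀ x → IsAB u w x → x ∉ S) ×
      ∃[ x ] ∃[ y ] (x ≢ y × Branch v u x × Branch v u y × x ∈ S × y ∈ S ×
                     2 + d v w ≤ d v x × 2 + d v w ≤ d v y)
    TypeM3 u w = (∃[ x ] ∃[ y ] (x ≢ y × Branch v u x × Branch v u y × x ∈ S × y ∈ S)) ×
      ∃[ z ] (IsAB u w z × z ∈ S)

  IsLocalSet : Fin n → Subset n → Set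
  IsLocalSet v S =
    (∀ x → x ∈ S → ∃[ u ] (GLeg v u × Branch v u x)) ×
    (∀ u u′ → Leg v u → Leg v u′ → TypeS0 u → TypeS0 u′ → u ≡ u′) ×
    (∀ u → Leg v u → ¬ TypeS0 u → TypeS1 u ⊎ TypeS2 u ⊎ TypeS3 u) ×
    (∀ u w → ModLeg v u w → TypeM1 u w ⊎ TypeM2 u w ⊎ TypeM3 u w) ×
    (∀ u → Leg v u → TypeS0 u → ∀ u′ w → ModLeg v u′ w → ¬ TypeM1 u′ w) ×
    (∀ u → LongLeg v u → TypeS0 u → ∀ u′ → LongLeg v u′ → u′ ≢ u → TypeS2 u′) ×
    (∀ u → ShortLeg v u → TypeS0 u → ∀ u′ → LongLeg v u′ → TypeS2 u′ ⊎ TypeS3 u′)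
    where open Types S v

open TreeDefs public

module Submission where

-- Let S be the set of landmarks lying on some g-leg of the core
-- v.  Then S ⊆ L by construction, and every clause of the definition of a
-- local set follows from the landmark property through one geometric fact:
-- if x and y lie in the subtrees of two neighbours a, b of v and have the
-- same distance from v, then every vertex separating x and y lies in one of
-- these two subtrees (any other vertex sees both through v).  Hence two
-- vertices of g-legs outside L that are equidistant from v force two
-- landmarks into those legs; choosing the pair (roots of legs, vertices of
-- position 2, roots of the legs of a small core) clause by clause yields the
-- required solution types.

open import Defs
open import Data.Nat using (ℕ)
open import Data.Fin using (Fin)
open import Data.Fin.Subset using (Subset; _⊆_)
open import Data.Product using (∃; ∃-syntax; _×_)

open import Data.Nat using (suc; _+_; _≤_; z≤n; s≤s; _≤?_) renaming (_≟_ to _≟ℕ_)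
open import Data.Nat.Properties
open import Data.Fin using () renaming (_≟_ to _≟ᶠ_)
open import Data.Fin.Properties using (any?; all?)
open import Data.Fin.Subset using (_∈_; _∉_; _∩_)
open import Data.Fin.Subset.Properties using (_∈?_; x∈p∩q⁺; x∈p∩q⁻)
open import Data.Product using (_,_; proj₁; proj₂)
open import Data.Sum using (_⊎_; inj₁; inj₂)
open import Data.Empty using (⊥; ⊥-elim)
open import Data.Bool using (Bool; T; T?)
open import Data.Bool.Properties using (T-≡)
open import Data.Vec using (tabulate)
open import Data.Vec.Properties using (lookup∘tabulate; lookup⇒[]=; []=⇒lookup)
open import Data.List using (List; []; _∷_)
open import Data.List.Relation.Unary.Any using (here; there) renaming (any? to anyₗ?)
open import Data.List.Relation.Unary.All using ([]) renaming (lookup to All-lookup)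
open import Data.List.Relation.Unary.All.Properties using (¬Any⇒All¬)
open import Data.List.Relation.Unary.AllPairs using ([]; _∷_)
open import Data.List.Membership.Propositional using () renaming (_∈_ to _∈ₗ_; _∉_ to _∉ₗ_)
open import Data.List.Relation.Binary.Subset.Propositional using () renaming (_⊆_ to _⊆ₗ_)
open import Function.Bundles using (Equivalence)
open import Relation.Nullary using (¬_; Dec; yes; no; isYes)
open import Relation.Nullary.Decidable using (_×-dec_; _⊎-dec_; _→-dec_; ¬?; toWitness; fromWitness)
open import Relation.Binary.PropositionalEquality

select : ∀ {n} {P : Fin n → Set} → (∀ x → Dec (P x)) → Subset n
select P? = tabulate (λ x → isYes (P? x))

select⁺ : ∀ {n} {P : Fin n → Set} (P? : ∀ x → Dec (P x)) {x} → P x → x ∈ select P?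
select⁺ P? {x} p =
  lookup⇒[]= x _ (trans (lookup∘tabulate _ x) (Equivalence.to T-≡ (fromWitness p)))

select⁻ : ∀ {n} {P : Fin n → Set} (P? : ∀ x → Dec (P x)) {x} → x ∈ select P? → P x
select⁻ P? {x} m =
  toWitness {a? = P? x} (Equivalence.from T-≡ (trans (sym (lookup∘tabulate _ x)) ([]=⇒lookup m)))

module WalkFacts {n : ℕ} (adj : Fin n → Fin n → Bool) where
  open WalkDefs adj using () renaming (Walk to W; verts to vs; len to ln; IsPath to Path)

  infixr 5 _++ʷ_
  _++ʷ_ : ∀ {x y z} → W x y → W y z → W x z
  [] ++ʷ q = q
  (e ∷ p) ++ʷ q = e ∷ (p ++ʷ q)

  len-++ : ∀ {x y z} (p : W x y) (q : W y z) → ln (p ++ʷ q) ≡ ln p + ln q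
  len-++ [] q = refl
  len-++ (e ∷ p) q = cong suc (len-++ p q)

  ∈-++⁻ : ∀ {x y z t} (p : W x y) (q : W y z) → t ∈ₗ vs (p ++ʷ q) → t ∈ₗ vs p ⊎ t ∈ₗ vs q
  ∈-++⁻ [] q m = inj₂ m
  ∈-++⁻ (e ∷ p) q (here t≡x) = inj₁ (here t≡x)
  ∈-++⁻ (e ∷ p) q (there m) with ∈-++⁻ p q m
  ... | inj₁ m′ = inj₁ (there m′)
  ... | inj₂ m′ = inj₂ m′

  start∈ : ∀ {x y} (p : W x y) → x ∈ₗ vs p
  start∈ [] = here refl
  start∈ (e ∷ p) = here refl

  end∈ : ∀ {x y} (p : W x y) → y ∈ₗ vs p
  end∈ [] = here refl
  end∈ (e ∷ p) = there (end∈ p)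

  len-pos : ∀ {x y} → x ≢ y → (p : W x y) → 1 ≤ ln p
  len-pos x≢y [] = ⊥-elim (x≢y refl)
  len-pos x≢y (e ∷ p) = s≤s z≤n

  record ShortPath (x y : Fin n) (xs : List (Fin n)) (k : ℕ) : Set where
    field
      path   : W x y
      isPath : Path path
      inside : vs path ⊆ₗ xs
      short  : ln path ≤ k

  suffix : ∀ {x y z} (p : W y z) → Path p → x ∈ₗ vs p → ShortPath x z (vs p) (ln p)
  suffix [] up (here refl) = record { path = [] ; isPath = up ; inside = λ m → m ; short = ≤-refl }
  suffix (e ∷ p) up (here refl) =
    record { path = e ∷ p ; isPath = up ; inside = λ m → m ; short = ≤-refl }
  suffix (e ∷ p) (_ ∷ up) (there m) =
    record { path = path ; isPath = isPath ; inside = λ t → there (inside t) ; short = m≤n⇒m≤1+n short }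
    where open ShortPath (suffix p up m)

  -- every walk contains a path with the same ends: shorten the tail to a path
  -- q, and if the first vertex x recurs on q, restart q from x
  toPath : ∀ {x y} (p : W x y) → ShortPath x y (vs p) (ln p)
  toPath [] = record { path = [] ; isPath = [] ∷ [] ; inside = λ m → m ; short = z≤n }
  toPath {x} (e ∷ p) with toPath p
  ... | record { path = q ; isPath = uq ; inside = q⊆p ; short = q≤p } with anyₗ? (x ≟ᶠ_) (vs q)
  ...   | yes x∈q =
    record { path = path ; isPath = isPath ; inside = λ t → there (q⊆p (inside t))
           ; short = ≤-trans short (m≤n⇒m≤1+n q≤p) }
    where open ShortPath (suffix q uq x∈q)
  ...   | no x∉q =
    record { path = e ∷ q ; isPath = ¬Any⇒All¬ _ x∉q ∷ uq ; inside = grow ; short = s≤s q≤p }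
    where
      grow : vs (e ∷ q) ⊆ₗ vs (e ∷ p)
      grow (here t≡x) = here t≡x
      grow (there t) = there (q⊆p t)

module TreeMetric {n : ℕ} (𝒯 : Tree n) where
  open Tree 𝒯
  open WalkDefs adj using () renaming (Walk to W; verts to vs; len to ln; IsPath to Path)
  open WalkFacts adj
  open TreeDefs 𝒯 using () renaming (d to dist; Branch to Br)

  adj-flip : ∀ {x y} → T (adj x y) → T (adj y x)
  adj-flip {x} {y} = subst T (adj-sym x y)

  adj⇒≢ : ∀ {x y} → T (adj x y) → x ≢ y
  adj⇒≢ {x} e refl = subst T (adj-irr x) e

  reverse : ∀ {x y} → W x y → W y x
  reverse [] = []
  reverse (e ∷ p) = reverse p ++ʷ (adj-flip e ∷ [])

  len-reverse : ∀ {x y} (p : W x y) → ln (reverse p) ≡ ln p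
  len-reverse [] = refl
  len-reverse (e ∷ p) =
    trans (len-++ (reverse p) _) (trans (+-comm _ 1) (cong suc (len-reverse p)))

  reverse-⊆ : ∀ {x y} (p : W x y) → vs (reverse p) ⊆ₗ vs p
  reverse-⊆ [] m = m
  reverse-⊆ (e ∷ p) m with ∈-++⁻ (reverse p) _ m
  ... | inj₁ m′ = there (reverse-⊆ p m′)
  ... | inj₂ (here refl) = there (start∈ p)
  ... | inj₂ (there (here refl)) = here refl

  -- If they
  -- leave x through different neighbours a ≠ b, the walk a ⋯ y ⋯ b contains
  -- a path avoiding x, which closes a cycle with the edges x a and b x.
  path-length-unique : ∀ {x y} (p q : W x y) → Path p → Path q → ln p ≡ ln q
  path-length-unique [] [] _ _ = refl
  path-length-unique [] (e ∷ q) _ (x∉q ∷ _) = ⊥-elim (All-lookup x∉q (end∈ q) refl)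
  path-length-unique (e ∷ p) [] (x∉p ∷ _) _ = ⊥-elim (All-lookup x∉p (end∈ p) refl)
  path-length-unique {x} (_∷_ {y = a} e p) (_∷_ {y = b} f q) (x∉p ∷ up) (x∉q ∷ uq) with a ≟ᶠ b
  ... | yes refl = cong suc (path-length-unique p q up uq)
  ... | no a≢b =
    ⊥-elim (acyclic x b (e ∷ path) (¬Any⇒All¬ _ x∉path ∷ isPath) (s≤s (len-pos a≢b path)) (adj-flip f))
    where
      open ShortPath (toPath (p ++ʷ reverse q))
      x∉path : x ∉ₗ vs path
      x∉path m with ∈-++⁻ p (reverse q) (inside m)
      ... | inj₁ m′ = All-lookup x∉p m′ refl
      ... | inj₂ m′ = All-lookup x∉q (reverse-⊆ q m′) refl

  geodesic : ∀ x y → W x y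
  geodesic x y = proj₁ (connected x y)

  dist-path : ∀ {x y} (p : W x y) → Path p → dist x y ≡ ln p
  dist-path {x} {y} p up = path-length-unique (geodesic x y) p (proj₂ (connected x y)) up

  dist≤len : ∀ {x y} (p : W x y) → dist x y ≤ ln p
  dist≤len p = ≤-trans (≤-reflexive (dist-path path isPath)) short
    where open ShortPath (toPath p)

  dist-refl : ∀ {x} → dist x x ≡ 0
  dist-refl = n≤0⇒n≡0 (dist≤len [])

  dist-pos : ∀ {x y} → x ≢ y → 1 ≤ dist x y
  dist-pos {x} {y} x≢y = len-pos x≢y (geodesic x y)

  dist≡0⇒≡ : ∀ {x y} → dist x y ≡ 0 → x ≡ y
  dist≡0⇒≡ {x} {y} eq with x ≟ᶠ y
  ... | yes x≡y = x≡y
  ... | no x≢y with subst (1 ≤_) eq (dist-pos x≢y)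
  ...   | ()

  dist-sym : ∀ {x y} → dist x y ≡ dist y x
  dist-sym {x} {y} = ≤-antisym (bound y x) (bound x y)
    where
      bound : ∀ a b → dist b a ≤ dist a b
      bound a b = ≤-trans (dist≤len (reverse (geodesic a b))) (≤-reflexive (len-reverse (geodesic a b)))

  dist-tri : ∀ {x y z} → dist x z ≤ dist x y + dist y z
  dist-tri {x} {y} {z} =
    ≤-trans (dist≤len (geodesic x y ++ʷ geodesic y z)) (≤-reflexive (len-++ (geodesic x y) _))

  dist-adj : ∀ {x y} → T (adj x y) → dist x y ≡ 1
  dist-adj e = ≤-antisym (dist≤len (e ∷ [])) (dist-pos (adj⇒≢ e))

  dist-via : ∀ {x y c} (p : W x y) → c ∈ₗ vs p → dist x c + dist c y ≤ ln p
  dist-via {x} [] (here refl) = ≤-reflexive (cong₂ _+_ (dist-refl {x}) (dist-refl {x}))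
  dist-via {x} {y} (e ∷ p) (here refl) =
    ≤-trans (≤-reflexive (cong (_+ dist x y) (dist-refl {x}))) (dist≤len (e ∷ p))
  dist-via {x} {y} {c} (_∷_ {y = x₁} e p) (there m) =
    ≤-trans (+-monoˡ-≤ (dist c y) step) (s≤s (dist-via p m))
    where
      step : dist x c ≤ suc (dist x₁ c)
      step = ≤-trans (dist-tri {x} {x₁} {c}) (≤-reflexive (cong (_+ dist x₁ c) (dist-adj e)))

  branch⇒dist : ∀ {c a x} → Br c a x → dist c x ≡ suc (dist a x)
  branch⇒dist {c} (ca , p , c∉p) =
    trans (dist-path (ca ∷ path) (¬Any⇒All¬ _ (λ m → c∉p (inside m)) ∷ isPath))
          (cong suc (sym (dist-path path isPath)))
    where open ShortPath (toPath p)

  dist⇒branch : ∀ {c a x} → T (adj c a) → dist c x ≡ suc (dist a x) → Br c a x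
  dist⇒branch {c} {a} {x} ca eq with anyₗ? (c ≟ᶠ_) (vs (geodesic a x))
  ... | no c∉geo = ca , geodesic a x , c∉geo
  ... | yes c∈geo = ⊥-elim (1+n≰n (≤-trans (n≤1+n _) too-long))
    where
      -- the geodesic a ⋯ x would pass through c at distance 1 from a
      too-long : 2 + dist a x ≤ dist a x
      too-long = subst₂ (λ s t → s + t ≤ dist a x) (dist-adj (adj-flip ca)) eq
                        (dist-via (geodesic a x) c∈geo)

  branch? : ∀ c a x → Dec (Br c a x)
  branch? c a x with T? (adj c a)
  ... | no ¬ca = no (λ b → ¬ca (proj₁ b))
  ... | yes ca with dist c x ≟ℕ suc (dist a x)
  ...   | yes eq = yes (dist⇒branch ca eq)
  ...   | no neq = no (λ b → neq (branch⇒dist b))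

  root∈branch : ∀ {c a} → T (adj c a) → Br c a a
  root∈branch ca = ca , [] , λ { (here c≡a) → adj⇒≢ ca c≡a }

  branch-depth : ∀ {c a x} → Br c a x → x ≢ a → 2 ≤ dist c x
  branch-depth bx x≢a = subst (2 ≤_) (sym (branch⇒dist bx)) (s≤s (dist-pos (≢-sym x≢a)))

  branch-second-vertex : ∀ {c a x} → Br c a x → x ≢ a → ∃[ z ] (Br c a z × z ≢ a × dist c z ≡ 2)
  branch-second-vertex (ca , [] , c∉p) x≢a = ⊥-elim (x≢a refl)
  branch-second-vertex {c} {a} (ca , _∷_ {y = z} e p , c∉p) x≢a =
    z , za , ≢-sym (adj⇒≢ e) , trans (branch⇒dist za) (cong suc (dist-adj e))
    where
      za : Br c a z
      za = ca , e ∷ [] , λ { (here c≡a) → c∉p (here c≡a)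
                           ; (there (here c≡z)) → c∉p (there (subst (_∈ₗ vs p) (sym c≡z) (start∈ p))) }

  dist-through : ∀ {c a t y} → Br c a t → ¬ Br c a y → dist t y ≡ dist t c + dist c y
  dist-through {c} {a} {t} {y} (ca , p , c∉p) y∉a with anyₗ? (c ≟ᶠ_) (vs (geodesic t y))
  ... | yes c∈geo = ≤-antisym dist-tri (dist-via (geodesic t y) c∈geo)
  ... | no c∉geo = ⊥-elim (y∉a (ca , p ++ʷ geodesic t y , c∉walk))
    where
      c∉walk : c ∉ₗ vs (p ++ʷ geodesic t y)
      c∉walk m with ∈-++⁻ p _ m
      ... | inj₁ m′ = c∉p m′
      ... | inj₂ m′ = c∉geo m′

  branches-disjoint : ∀ {c a b z} → a ≢ b → Br c a z → Br c b z → ⊥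
  branches-disjoint {c} {a} {b} {z} a≢b za zb with branch? c a b
  ... | yes ba = a≢b (dist≡0⇒≡ (suc-injective (trans (sym (branch⇒dist ba)) (dist-adj (proj₁ zb)))))
  ... | no b∉a = m≢1+m+n (dist b z) (begin
      dist b z           ≡⟨ dist-sym ⟩
      dist z b           ≡⟨ dist-through za b∉a ⟩
      dist z c + dist c b ≡⟨ cong₂ _+_ (trans dist-sym (branch⇒dist zb)) (dist-adj (proj₁ zb)) ⟩
      suc (dist b z) + 1 ∎)
    where open ≡-Reasoning

  nested-branch : ∀ {v u w b τ} → Br v u w → ¬ Br w b v → Br w b τ →
                  Br v u τ × dist v τ ≡ dist v w + dist w τ
  nested-branch {v} {u} {w} {b} {τ} wu v∉b τb = dist⇒branch (proj₁ wu) (≤-antisym upper lower) , additive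
    where
      open ≤-Reasoning
      additive : dist v τ ≡ dist v w + dist w τ
      additive = begin-equality
        dist v τ            ≡⟨ dist-sym ⟩
        dist τ v            ≡⟨ dist-through τb v∉b ⟩
        dist τ w + dist w v ≡⟨ +-comm (dist τ w) _ ⟩
        dist w v + dist τ w ≡⟨ cong₂ _+_ (dist-sym {w}) (dist-sym {τ}) ⟩
        dist v w + dist w τ ∎
      upper : dist v τ ≤ suc (dist u τ)
      upper = ≤-trans (dist-tri {v} {u} {τ}) (≤-reflexive (cong (_+ dist u τ) (dist-adj (proj₁ wu))))
      lower : suc (dist u τ) ≤ dist v τ
      lower = begin
        suc (dist u τ)             ≤⟨ s≤s (dist-tri {u} {w} {τ}) ⟩
        suc (dist u w) + dist w τ  ≡⟨ cong (_+ dist w τ) (sym (branch⇒dist wu)) ⟩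
        dist v w + dist w τ        ≡⟨ sym additive ⟩
        dist v τ ∎

  separator-in-branches : ∀ {c a b x y τ} → Br c a x → Br c b y → dist c x ≡ dist c y →
                          Separates 𝒯 τ x y → Br c a τ ⊎ Br c b τ
  separator-in-branches {c} {a} {b} {x} {y} {τ} xa yb eq sep with branch? c a τ | branch? c b τ
  ... | yes τa | _ = inj₁ τa
  ... | no _ | yes τb = inj₂ τb
  ... | no τ∉a | no τ∉b = ⊥-elim (sep (begin
      dist x τ            ≡⟨ dist-through xa τ∉a ⟩
      dist x c + dist c τ ≡⟨ cong (_+ dist c τ) (trans dist-sym (trans eq dist-sym)) ⟩
      dist y c + dist c τ ≡⟨ sym (dist-through yb τ∉b) ⟩
      dist y τ ∎))
    where open ≡-Reasoning

module LegDecidability {n : ℕ} (𝒯 : Tree n) where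
  open Tree 𝒯
  open TreeMetric 𝒯 using (branch?)
  open TreeDefs 𝒯 using () renaming (Branch to Br)

  core? : ∀ c → Dec (Core 𝒯 c)
  core? c = 3 ≤? deg 𝒯 c

  leg? : ∀ w u → Dec (Leg 𝒯 w u)
  leg? w u = T? (adj w u) ×-dec all? (λ c → branch? w u c →-dec ¬? (core? c))

  short? : ∀ w u → Dec (ShortLeg 𝒯 w u)
  short? w u = leg? w u ×-dec all? (λ x → branch? w u x →-dec (x ≟ᶠ u))

  small? : ∀ w → Dec (SmallCore 𝒯 w)
  small? w = core? w ×-dec (deg 𝒯 w ≟ℕ 3) ×-dec
    any? (λ u₁ → any? (λ u₂ → ¬? (u₁ ≟ᶠ u₂) ×-dec leg? w u₁ ×-dec leg? w u₂ ×-dec short? w u₁))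

  modLeg? : ∀ v u w → Dec (ModLeg 𝒯 v u w)
  modLeg? v u w = T? (adj v u) ×-dec branch? v u w ×-dec small? w ×-dec
    all? (λ c → branch? v u c →-dec (core? c →-dec (c ≟ᶠ w)))

  gLeg? : ∀ v u → Dec (GLeg 𝒯 v u)
  gLeg? v u = leg? v u ⊎-dec any? (modLeg? v u)

  OnGLeg : Fin n → Fin n → Set
  OnGLeg v x = ∃[ u ] (GLeg 𝒯 v u × Br v u x)

  onGLeg? : ∀ v x → Dec (OnGLeg v x)
  onGLeg? v x = any? (λ u → gLeg? v u ×-dec branch? v u x)

module LocalSetConstruction {n : ℕ} (𝒯 : Tree n) (L : Subset n) (landmark : IsLandmarkSet 𝒯 L)
                            (v : Fin n) (v-core : Core 𝒯 v) where
  open Tree 𝒯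
  open TreeMetric 𝒯
  open LegDecidability 𝒯
  open TreeDefs 𝒯 using () renaming (d to dist; Branch to Br)

  two-separators : ∀ {x y} (P : Fin n → Set) → x ≢ y → x ∉ L → y ∉ L →
                   (∀ {τ} → τ ∈ L → Separates 𝒯 τ x y → P τ) →
                   ∃[ τ₁ ] ∃[ τ₂ ] (τ₁ ≢ τ₂ × τ₁ ∈ L × τ₂ ∈ L × P τ₁ × P τ₂)
  two-separators {x} {y} P x≢y x∉L y∉L sep⇒P =
    let τ₁ , τ₂ , τ₁≢τ₂ , τ₁∈L , τ₂∈L , sep₁ , sep₂ = landmark x y x≢y x∉L y∉L
    in τ₁ , τ₂ , τ₁≢τ₂ , τ₁∈L , τ₂∈L , sep⇒P τ₁∈L sep₁ , sep⇒P τ₂∈L sep₂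

  -- The proof
  -- only uses the membership facts below; keeping S abstract stops the type
  -- checker from unfolding its vector representation.
  abstract
    S : Subset n
    S = L ∩ select (onGLeg? v)

    S⊆L : S ⊆ L
    S⊆L m = proj₁ (x∈p∩q⁻ L _ m)

    S⊆gLegs : ∀ x → x ∈ S → OnGLeg v x
    S⊆gLegs x m = select⁻ (onGLeg? v) (proj₂ (x∈p∩q⁻ L _ m))

    ∈S : ∀ {u x} → GLeg 𝒯 v u → Br v u x → x ∈ L → x ∈ S
    ∈S g xu x∈L = x∈p∩q⁺ (x∈L , select⁺ (onGLeg? v) (_ , g , xu))

  ∉L : ∀ {u x} → GLeg 𝒯 v u → Br v u x → x ∉ S → x ∉ L
  ∉L g xu x∉S x∈L = x∉S (∈S g xu x∈L)

  open Types 𝒯 S v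

  gLeg-adj : ∀ {u} → GLeg 𝒯 v u → T (adj v u)
  gLeg-adj (inj₁ leg) = proj₁ leg
  gLeg-adj (inj₂ (_ , modLeg)) = proj₁ modLeg

  root∈S : ∀ {u} → GLeg 𝒯 v u → u ∈ L → u ∈ S
  root∈S g = ∈S g (root∈branch (gLeg-adj g))

  empty-root∉L : ∀ {u} → GLeg 𝒯 v u → TypeS0 u → u ∉ L
  empty-root∉L g u-empty u∈L = u-empty _ (root∈branch (gLeg-adj g)) (root∈S g u∈L)

  v∉leg : ∀ {w b} → Leg 𝒯 w b → ¬ Br w b v
  v∉leg leg vb = proj₂ leg v vb v-core

  -- Two equidistant vertices x ≠ y on g-legs a, b of v with a of type (s,0)
  -- and y ∉ L: no landmark separating them lies in a, so both lie in b and
  -- b has type (s,2).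
  two-landmarks : ∀ {a b x y} → GLeg 𝒯 v a → TypeS0 a → GLeg 𝒯 v b → Br v a x → Br v b y →
                  dist v x ≡ dist v y → x ≢ y → y ∉ L → TypeS2 b
  two-landmarks {a} {b} {x} {y} ga a-empty gb xa yb eq x≢y y∉L =
    let τ₁ , τ₂ , τ₁≢τ₂ , τ₁∈L , τ₂∈L , τ₁b , τ₂b =
          two-separators (Br v b) x≢y (∉L ga xa (a-empty x xa)) y∉L in-b
    in τ₁ , τ₂ , τ₁≢τ₂ , τ₁b , τ₂b , ∈S gb τ₁b τ₁∈L , ∈S gb τ₂b τ₂∈L
    where
      in-b : ∀ {τ} → τ ∈ L → Separates 𝒯 τ x y → Br v b τ
      in-b {τ} τ∈L sep with separator-in-branches xa yb eq sep
      ... | inj₁ τa = ⊥-elim (a-empty τ τa (∈S ga τa τ∈L))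
      ... | inj₂ τb = τb

  two-landmarks-roots : ∀ {a b} → GLeg 𝒯 v a → TypeS0 a → GLeg 𝒯 v b → a ≢ b → b ∉ L → TypeS2 b
  two-landmarks-roots ga a-empty gb a≢b b∉L =
    two-landmarks ga a-empty gb (root∈branch (gLeg-adj ga)) (root∈branch (gLeg-adj gb))
      (trans (dist-adj (gLeg-adj ga)) (sym (dist-adj (gLeg-adj gb)))) a≢b b∉L

  second-or-only : ∀ u x → (∃[ y ] (Br v u y × y ∈ S × y ≢ x)) ⊎ (∀ y → Br v u y → y ∈ S → y ≡ x)
  second-or-only u x with any? (λ y → branch? v u y ×-dec y ∈? S ×-dec ¬? (y ≟ᶠ x))
  ... | yes second = inj₁ second
  ... | no ¬second = inj₂ only
    where
      only : ∀ y → Br v u y → y ∈ S → y ≡ x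
      only y yu y∈S with y ≟ᶠ x
      ... | yes y≡x = y≡x
      ... | no y≢x = ⊥-elim (¬second (y , yu , y∈S , y≢x))

  -- Clause (1): two standard legs of type (s,0) would have roots outside L
  -- whose separators lie in neither leg.
  one-empty-leg : ∀ u u′ → Leg 𝒯 v u → Leg 𝒯 v u′ → TypeS0 u → TypeS0 u′ → u ≡ u′
  one-empty-leg u u′ lu lu′ u-empty u′-empty with u ≟ᶠ u′
  ... | yes u≡u′ = u≡u′
  ... | no u≢u′
    with two-landmarks-roots (inj₁ lu) u-empty (inj₁ lu′) u≢u′ (empty-root∉L (inj₁ lu′) u′-empty)
  ...   | τ , _ , _ , τu′ , _ , τ∈S , _ = ⊥-elim (u′-empty τ τu′ τ∈S)

  nonempty-leg-type : ∀ u → Leg 𝒯 v u → ¬ TypeS0 u → TypeS1 u ⊎ TypeS2 u ⊎ TypeS3 u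
  nonempty-leg-type u lu nonempty with any? (λ x → branch? v u x ×-dec x ∈? S)
  ... | no none = ⊥-elim (nonempty (λ x xu x∈S → none (x , xu , x∈S)))
  ... | yes (x , xu , x∈S) with second-or-only u x
  ...   | inj₁ (y , yu , y∈S , y≢x) = inj₂ (inj₁ (x , y , ≢-sym y≢x , xu , yu , x∈S , y∈S))
  ...   | inj₂ only with x ≟ᶠ u
  ...     | yes refl = inj₂ (inj₂ (x∈S , only))
  ...     | no x≢u = inj₁ (x , xu , x∈S , branch-depth xu x≢u , only)

  leg-root-is-AB : ∀ {u w b} → Br v u w → Leg 𝒯 w b → IsAB u w b
  leg-root-is-AB {w = w} wu leg =
    let bu , additive = nested-branch wu (v∉leg leg) (root∈branch (proj₁ leg))
    in bu , trans additive (trans (cong (dist v w +_) (dist-adj (proj₁ leg))) (+-comm _ 1))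

  deep-in-leg : ∀ {u w b τ} → Br v u w → Leg 𝒯 w b → Br w b τ → τ ≢ b →
                Br v u τ × 2 + dist v w ≤ dist v τ
  deep-in-leg {w = w} wu leg τb τ≢b =
    let τu , additive = nested-branch wu (v∉leg leg) τb
    in τu , ≤-trans (≤-reflexive (+-comm 2 _))
                    (≤-trans (+-monoʳ-≤ (dist v w) (branch-depth τb τ≢b)) (≤-reflexive (sym additive)))

  -- If S avoids ℓᵃ and ℓᵇ, the roots u₁ (of a short leg) and u₂ of two legs
  -- of w are not landmarks; their separators are not u₁, hence lie deeper in
  -- the leg of u₂, which gives type (m,2).
  modLeg-without-AB : ∀ {u w u₁ u₂} → GLeg 𝒯 v u → Br v u w → Leg 𝒯 w u₁ → Leg 𝒯 w u₂ →
                      ShortLeg 𝒯 w u₁ → u₁ ≢ u₂ → (∀ x → IsAB u w x → x ∉ S) → TypeM2 u w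
  modLeg-without-AB {u} {w} {u₁} {u₂} g wu leg₁ leg₂ short₁ u₁≢u₂ no-AB =
    let τ₁ , τ₂ , τ₁≢τ₂ , τ₁∈L , τ₂∈L , (τ₁u , τ₁-deep) , (τ₂u , τ₂-deep) =
          two-separators Deep u₁≢u₂ (root∉L leg₁) (root∉L leg₂) deep
    in no-AB , τ₁ , τ₂ , τ₁≢τ₂ , τ₁u , τ₂u ,
       ∈S g τ₁u τ₁∈L , ∈S g τ₂u τ₂∈L , τ₁-deep , τ₂-deep
    where
      Deep : Fin n → Set
      Deep τ = Br v u τ × 2 + dist v w ≤ dist v τ
      root∉L : ∀ {b} → Leg 𝒯 w b → b ∉ L
      root∉L leg = ∉L g (proj₁ (leg-root-is-AB wu leg)) (no-AB _ (leg-root-is-AB wu leg))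
      deep : ∀ {τ} → τ ∈ L → Separates 𝒯 τ u₁ u₂ → Deep τ
      deep {τ} τ∈L sep
        with separator-in-branches (root∈branch (proj₁ leg₁)) (root∈branch (proj₁ leg₂))
               (trans (dist-adj (proj₁ leg₁)) (sym (dist-adj (proj₁ leg₂)))) sep
      ... | inj₁ τu₁ = ⊥-elim (root∉L leg₁ (subst (_∈ L) (proj₂ short₁ τ τu₁) τ∈L))
      ... | inj₂ τu₂ = deep-in-leg wu leg₂ τu₂ (λ τ≡u₂ → root∉L leg₂ (subst (_∈ L) τ≡u₂ τ∈L))

  modLeg-type : ∀ u w → ModLeg 𝒯 v u w → TypeM1 u w ⊎ TypeM2 u w ⊎ TypeM3 u w
  modLeg-type u w ml@(_ , wu , (_ , _ , u₁ , u₂ , u₁≢u₂ , leg₁ , leg₂ , short₁) , _)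
    with any? (λ z → (branch? v u z ×-dec dist v z ≟ℕ suc (dist v w)) ×-dec z ∈? S)
  ... | no ¬AB = inj₂ (inj₁ (modLeg-without-AB (inj₂ (w , ml)) wu leg₁ leg₂ short₁ u₁≢u₂
                                              (λ x x-AB x∈S → ¬AB (x , x-AB , x∈S))))
  ... | yes (z , z-AB , z∈S) with second-or-only u z
  ...   | inj₁ (y , yu , y∈S , y≢z) =
    inj₂ (inj₂ ((z , y , ≢-sym y≢z , proj₁ z-AB , yu , z∈S , y∈S) , z , z-AB , z∈S))
  ...   | inj₂ only = inj₁ (z , z-AB , z∈S , only)

  leg≢modLeg : ∀ {u u′ w} → Leg 𝒯 v u → ModLeg 𝒯 v u′ w → u ≢ u′
  leg≢modLeg lu (_ , wu′ , (w-core , _) , _) refl = proj₂ lu _ wu′ w-core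

  -- in a modified leg of type (m,1) the root (position 1) is not a landmark,
  -- since the single element of S has position i + 1 ≥ 2
  M1-root∉L : ∀ {u w} → ModLeg 𝒯 v u w → TypeM1 u w → u ∉ L
  M1-root∉L {u} {w} ml@(vu , wu , _) (x , (_ , x-pos) , _ , only) u∈L
    with (begin
      1                       ≡⟨ sym (dist-adj vu) ⟩
      dist v u                ≡⟨ cong (dist v) (only u (root∈branch vu) (root∈S (inj₂ (w , ml)) u∈L)) ⟩
      dist v x                ≡⟨ x-pos ⟩
      suc (dist v w)          ≡⟨ cong suc (branch⇒dist wu) ⟩
      suc (suc (dist u w))    ∎)
    where open ≡-Reasoning
  ... | ()

  -- Clause (3): with an empty standard leg, the landmarks separating its
  -- root from the root of a modified leg of type (m,1) would be two elements
  -- of S in that leg.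
  empty-leg-excludes-M1 : ∀ u → Leg 𝒯 v u → TypeS0 u → ∀ u′ w → ModLeg 𝒯 v u′ w → ¬ TypeM1 u′ w
  empty-leg-excludes-M1 u lu u-empty u′ w ml m1@(_ , _ , _ , only)
    with two-landmarks-roots (inj₁ lu) u-empty (inj₂ (w , ml)) (leg≢modLeg lu ml) (M1-root∉L ml m1)
  ... | τ₁ , τ₂ , τ₁≢τ₂ , τ₁u′ , τ₂u′ , τ₁∈S , τ₂∈S =
    τ₁≢τ₂ (trans (only τ₁ τ₁u′ τ₁∈S) (sym (only τ₂ τ₂u′ τ₂∈S)))

  longLeg-gLeg : ∀ {u} → LongLeg 𝒯 v u → GLeg 𝒯 v u
  longLeg-gLeg lu = inj₁ (proj₁ lu)

  longLeg-root : ∀ {u} → LongLeg 𝒯 v u → Br v u u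
  longLeg-root lu = root∈branch (proj₁ (proj₁ lu))

  longLeg-position-2 : ∀ {u} → LongLeg 𝒯 v u → ∃[ z ] (Br v u z × z ≢ u × dist v z ≡ 2)
  longLeg-position-2 (_ , x , xu , x≢u) = branch-second-vertex xu x≢u

  -- If u′ ∉ L, separate the roots; otherwise u′ ∈ S, and either the
  -- vertex z′ of position 2 of u′ is in L too, or the pair z, z′ of
  -- position-2 vertices supplies the landmarks.
  long-legs-full : ∀ u → LongLeg 𝒯 v u → TypeS0 u →
                   ∀ u′ → LongLeg 𝒯 v u′ → u′ ≢ u → TypeS2 u′
  long-legs-full u lu u-empty u′ lu′ u′≢u with u′ ∈? L
  ... | no u′∉L = two-landmarks-roots (longLeg-gLeg lu) u-empty (longLeg-gLeg lu′) (≢-sym u′≢u) u′∉L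
  ... | yes u′∈L with longLeg-position-2 lu | longLeg-position-2 lu′
  ...   | z , zu , _ , z-pos | z′ , z′u′ , z′≢u′ , z′-pos with z′ ∈? L
  ...     | yes z′∈L =
    u′ , z′ , ≢-sym z′≢u′ , longLeg-root lu′ , z′u′ ,
    root∈S (longLeg-gLeg lu′) u′∈L , ∈S (longLeg-gLeg lu′) z′u′ z′∈L
  ...     | no z′∉L =
    two-landmarks (longLeg-gLeg lu) u-empty (longLeg-gLeg lu′) zu z′u′ (trans z-pos (sym z′-pos))
      (λ z≡z′ → branches-disjoint (≢-sym u′≢u) zu (subst (Br v u′) (sym z≡z′) z′u′)) z′∉L

  short≢long : ∀ {u u′} → ShortLeg 𝒯 v u → LongLeg 𝒯 v u′ → u ≢ u′
  short≢long (_ , only-root) (_ , x , xu , x≢u) refl = x≢u (only-root x xu)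

  -- Clause (5): with an empty short leg, a long leg u′ has type (s,2) or
  -- (s,3): if u′ ∉ L separate the roots, otherwise u′ ∈ S.
  short-empty-long-legs : ∀ u → ShortLeg 𝒯 v u → TypeS0 u → ∀ u′ → LongLeg 𝒯 v u′ →
                          TypeS2 u′ ⊎ TypeS3 u′
  short-empty-long-legs u su u-empty u′ lu′ with u′ ∈? L
  ... | no u′∉L =
    inj₁ (two-landmarks-roots (inj₁ (proj₁ su)) u-empty (longLeg-gLeg lu′) (short≢long su lu′) u′∉L)
  ... | yes u′∈L with second-or-only u′ u′
  ...   | inj₁ (y , yu′ , y∈S , y≢u′) =
    inj₁ (u′ , y , ≢-sym y≢u′ , longLeg-root lu′ , yu′ , root∈S (longLeg-gLeg lu′) u′∈L , y∈S)
  ...   | inj₂ only = inj₂ (root∈S (longLeg-gLeg lu′) u′∈L , only)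

  isLocalSet : IsLocalSet 𝒯 v S
  isLocalSet = S⊆gLegs , one-empty-leg , nonempty-leg-type , modLeg-type ,
               empty-leg-excludes-M1 , long-legs-full , short-empty-long-legs


-- Every landmark set contains a local set of each core.
lemma2 : ∀ {n} (𝒯 : Tree n) → (∃[ c ] Core 𝒯 c) →
         (L : Subset n) → IsLandmarkSet 𝒯 L →
         (v : Fin n) → Core 𝒯 v →
         ∃[ S ] (S ⊆ L × IsLocalSet 𝒯 v S)
lemma2 𝒯 _ L landmark v v-core = S , S⊆L , isLocalSet
  where open LocalSetConstruction 𝒯 L landmark v v-core
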